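{- Let $0<\nu\leq\tau\ll\eta<1$ and let $R$ be a digraph on $k$ vertices with $\delta^0(R)\geq\eta k$. Suppose that $R$ is a robust $(\nu,\tau)$-outexpander and $F=V_1V_2\ldots V_k$ is a directed Hamilton cycle in $R$. Let $r:=\lceil 1/\nu\rceil$. Then for any pair of distinct vertices $A,B\in V(R)$ there exist a skewed traverse $T(A,B)$ of length at most $r$ and a shifted walk $W(A,B)$ traversing $F$ at most $r$ times.
   Context: $\delta^0(R)=\min(\delta^+(R),\delta^-(R))$. $RN^+_{\nu,R}(S)$ is the set of vertices with at least $\nu k$ inneighbours in $S$; $R$ is a robust $(\nu,\tau)$-outexpander if $|RN^+_{\nu,R}(S)|\geq|S|+\nu k$ for all $S$ with $\tau k<|S|<(1-\tau)k$. Indices of $V_i$ are taken modulo $k$. A skewed traverse from $A$ to $B$ of length $t$ is a collection of edges of $R$ of the form $AV_{i_1}, V_{i_1-1}V_{i_2}, V_{i_2-1}V_{i_3},\ldots, V_{i_t-1}B$. A shifted walk from $A$ to $B$ traversing $F$ $t$ times is a walk $AV_{i_1}FV_{i_1-1}V_{i_2}FV_{i_2-1}\ldots V_{i_t}FV_{i_t-1}B$ in $R$, where $V_iFV_{i-1}$ denotes the walk along $F$ from $V_i$ to $V_{i-1}$. The notation $a\ll b$ means $a$ is sufficiently small in terms of $b$. -}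

module Defs where

open import Data.Nat as ℕ using (ℕ; zero; suc)
open import Data.Nat.DivMod using (_%_; m%n<n)
open import Data.Integer as ℤ using (+_)
open import Data.Rational as ℚ using (ℚ; 0ℚ; 1ℚ; _/_; 1/_; ceiling; >-nonZero)
open import Data.Fin as Fin using (Fin; toℕ; fromℕ<)
open import Data.Fin.Subset using (Subset; ∣_∣; _∈_)
open import Data.Vec as Vec using (tabulate)
open import Data.Bool using (Bool; true; false)
open import Data.List as List using (List; []; _∷_; _++_; concat; map; length)
open import Data.List.Relation.Unary.Linked using (Linked)
open import Data.Product using (Σ; _×_; _,_)
open import Relation.Binary.PropositionalEquality using (_≡_)
open import Function.Bundles using (_↔_; Inverse)

ℕ→ℚ : ℕ → ℚ
ℕ→ℚ n = (+ n) / 1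

ceilInv : (ν : ℚ) → 0ℚ ℚ.< ν → ℕ
ceilInv ν ν>0 = ℤ.∣ ceiling (1/_ ν {{>-nonZero ν>0}}) ∣

record Digraph (k : ℕ) : Set where
  field
    E        : Fin k → Fin k → Bool
    loopless : ∀ v → E v v ≡ false
open Digraph public

Edge : ∀ {k} → Digraph k → Fin k → Fin k → Set
Edge R u v = E R u v ≡ true

count : ∀ {k} → (Fin k → Bool) → ℕ
count f = ∣ tabulate f ∣

outdeg indeg : ∀ {k} → Digraph k → Fin k → ℕ
outdeg R v = count (λ w → E R v w)
indeg  R v = count (λ w → E R w v)

MinSemiDegreeAtLeast : ∀ {k} → Digraph k → ℚ → Set
MinSemiDegreeAtLeast R x = ∀ v → (x ℚ.≤ ℕ→ℚ (outdeg R v)) × (x ℚ.≤ ℕ→ℚ (indeg R v))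

inNbrsIn : ∀ {k} → Digraph k → Subset k → Fin k → ℕ
inNbrsIn R S v = count (λ u → Data.Bool._∧_ (Vec.lookup S u) (E R u v))
  where import Data.Bool

InRobustOutNbhd : ∀ {k} → Digraph k → ℚ → Subset k → Fin k → Set
InRobustOutNbhd {k} R ν S v = ν ℚ.* ℕ→ℚ k ℚ.≤ ℕ→ℚ (inNbrsIn R S v)

-- R is a robust (ν,τ)-outexpander: for every S with τk < |S| < (1-τ)k,
-- the set RN⁺_{ν,R}(S) (any subset T equal to it) has |T| ≥ |S| + νk.
RobustOutexpander : ∀ {k} → Digraph k → ℚ → ℚ → Set
RobustOutexpander {k} R ν τ =
  ∀ (S T : Subset k) →
    (∀ v → (v ∈ T → InRobustOutNbhd R ν S v) × (InRobustOutNbhd R ν S v → v ∈ T)) →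
    τ ℚ.* ℕ→ℚ k ℚ.< ℕ→ℚ ∣ S ∣ →
    ℕ→ℚ ∣ S ∣ ℚ.< (1ℚ ℚ.- τ) ℚ.* ℕ→ℚ k →
    ℕ→ℚ ∣ S ∣ ℚ.+ ν ℚ.* ℕ→ℚ k ℚ.≤ ℕ→ℚ ∣ T ∣

-- Hamilton cycle F = V₁V₂…V_k: an enumeration V : Fin k ↔ Fin k of the
-- vertices (index i ↦ vertex V i) such that V i → V (i+1) is an edge,
-- indices taken modulo k.

_⊕_ : ∀ {k} → Fin k → ℕ → Fin k
_⊕_ {suc n} i m = fromℕ< (m%n<n (toℕ i ℕ.+ m) (suc n))

pred-mod : ∀ {k} → Fin k → Fin k
pred-mod {suc n} i = i ⊕ n

record HamiltonCycle {k : ℕ} (R : Digraph k) : Set where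
  field
    V      : Fin k ↔ Fin k
    cycleE : ∀ i → Edge R (Inverse.to V i) (Inverse.to V (i ⊕ 1))
open HamiltonCycle public

vtx : ∀ {k} {R : Digraph k} → HamiltonCycle R → Fin k → Fin k
vtx F i = Inverse.to (V F) i

-- Skewed traverse from A to B of length t, given by indices i₁,…,i_t:
-- edges A V_{i₁}, V_{i₁-1} V_{i₂}, …, V_{i_t-1} B of R.

SkewedTraverseFrom : ∀ {k} {R : Digraph k} → HamiltonCycle R →
                     Fin k → List (Fin k) → Fin k → Set
SkewedTraverseFrom {R = R} F A []       B = Edge R A B
SkewedTraverseFrom {R = R} F A (i ∷ is) B =
  Edge R A (vtx F i) × SkewedTraverseFrom F (vtx F (pred-mod i)) is B

SkewedTraverse : ∀ {k} {R : Digraph k} → HamiltonCycle R →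
                 Fin k → Fin k → ℕ → Set
SkewedTraverse {k} F A B t =
  Σ (List (Fin k)) λ is → (length is ≡ t) × SkewedTraverseFrom F A is B

IsWalk : ∀ {k} → Digraph k → List (Fin k) → Set
IsWalk R vs = Linked (Edge R) vs

-- V_i F V_{i-1}: the walk along F from V_i to V_{i-1}:
-- V_i, V_{i+1}, …, V_{i+k-1} = V_{i-1}
alongF : ∀ {k} {R : Digraph k} → HamiltonCycle R → Fin k → List (Fin k)
alongF {k} F i = map (λ m → vtx F (i ⊕ m)) (List.upTo k)

shiftedSeq : ∀ {k} {R : Digraph k} → HamiltonCycle R →
             Fin k → List (Fin k) → Fin k → List (Fin k)
shiftedSeq F A is B = A ∷ (concat (map (alongF F) is) ++ (B ∷ []))

ShiftedWalk : ∀ {k} {R : Digraph k} → HamiltonCycle R →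
              Fin k → Fin k → ℕ → Set
ShiftedWalk {k} {R} F A B t =
  Σ (List (Fin k)) λ is → (length is ≡ t) × IsWalk R (shiftedSeq F A is B)

-- Let X₀ be the set of vertices V_{i-1} with A V_i ∈ E(R), and X_{m+1} the set of V_{i-1} with
-- V_i ∈ RN⁺(X_m). Every u ∈ X_m is the last vertex of an open skewed traverse of length m+1 from A,
-- closed by any edge u B. Since i ↦ i-1 is a bijection, |X₀| = d⁺(A) ≥ ηk > τk, and robust expansion
-- gives |X_{m+1}| ≥ |X_m| + νk as long as |X_m| < (1-τ)k; as rν ≥ 1, some X_m with m < r has at least
-- (1-τ)k vertices, and then d⁻(B) ≥ ηk > τk forces an inneighbour of B in X_m. Replacing every vertex
-- V_i entered by a skewed edge with the walk V_iFV_{i-1} turns a skewed traverse into a shifted walk.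

module Submission where

open import Defs
open import Data.Nat as ℕ using (ℕ; zero; suc; _+_; z≤n; s≤s)
import Data.Nat.Properties as ℕₚ
open import Data.Nat.DivMod using (_%_; %-distribˡ-+; m%n%n≡m%n; [m+n]%n≡m%n; m<n⇒m%n≡m)
import Data.Integer as ℤ
import Data.Integer.Properties as ℤₚ
open import Data.Integer.DivMod using ([n/d]*d≤n)
open import Data.Rational as ℚ using (ℚ; 0ℚ; 1ℚ; ½; mkℚ; *≤*; *<*)
import Data.Rational.Properties as ℚₚ
open import Data.Rational.Solver using (module +-*-Solver)
import Data.Nat.Coprimality as Coprime
open import Data.Fin as Fin using (Fin; toℕ)
open import Data.Fin.Properties using (toℕ-fromℕ<; toℕ-injective; toℕ<n)
open import Data.Fin.Subset using (_∈_)
open import Data.Bool using (Bool; true; false; _∧_; if_then_else_)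
open import Data.Bool.Properties using (∧-conicalˡ; ∧-conicalʳ; T-≡)
open import Data.Vec using (tabulate; lookup)
open import Data.Vec.Properties using (lookup∘tabulate; []=⇒lookup; lookup⇒[]=)
open import Data.List using (List; []; _∷_; _++_; applyUpTo; concat; map; length)
open import Data.List.Properties using (++-assoc; map-upTo; length-++)
open import Data.List.Relation.Unary.Linked using (Linked; [-]; _∷_)
open import Data.Product as Product using (Σ; _×_; _,_; proj₁; proj₂; ∃)
open import Function using (_∘_; id)
open import Function.Bundles using (_↔_; Inverse; mk↔ₛ′; Equivalence)
open import Function.Construct.Composition using (_↔-∘_)
open import Function.Construct.Symmetry using (↔-sym)
open import Relation.Binary.PropositionalEquality
  using (_≡_; _≢_; refl; sym; trans; cong; cong₂; subst; subst₂; module ≡-Reasoning)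
open import Relation.Nullary using (does; yes; no; contradiction)
open import Relation.Nullary.Decidable using (dec-true; toWitness; isYes≗does)
import Algebra.Properties.CommutativeMonoid.Sum ℕₚ.+-0-commutativeMonoid as ℕΣ

module _ {n : ℕ} where

  toℕ-⊕ : (i : Fin (suc n)) (m : ℕ) → toℕ (i ⊕ m) ≡ (toℕ i + m) % suc n
  toℕ-⊕ i m = toℕ-fromℕ< _

  ⊕-+ : (i : Fin (suc n)) (a b : ℕ) → (i ⊕ a) ⊕ b ≡ i ⊕ (a + b)
  ⊕-+ i a b = toℕ-injective (begin
    toℕ ((i ⊕ a) ⊕ b)                             ≡⟨ toℕ-⊕ (i ⊕ a) b ⟩
    (toℕ (i ⊕ a) + b) % suc n                     ≡⟨ cong (λ x → (x + b) % suc n) (toℕ-⊕ i a) ⟩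
    ((toℕ i + a) % suc n + b) % suc n             ≡⟨ %-distribˡ-+ ((toℕ i + a) % suc n) b (suc n) ⟩
    ((toℕ i + a) % suc n % suc n + b % suc n) % suc n
      ≡⟨ cong (λ x → (x + b % suc n) % suc n) (m%n%n≡m%n (toℕ i + a) (suc n)) ⟩
    ((toℕ i + a) % suc n + b % suc n) % suc n     ≡⟨ %-distribˡ-+ (toℕ i + a) b (suc n) ⟨
    (toℕ i + a + b) % suc n                       ≡⟨ cong (_% suc n) (ℕₚ.+-assoc (toℕ i) a b) ⟩
    (toℕ i + (a + b)) % suc n                     ≡⟨ toℕ-⊕ i (a + b) ⟨
    toℕ (i ⊕ (a + b))                             ∎)
    where open ≡-Reasoning

  ⊕-identityʳ : (i : Fin (suc n)) → i ⊕ 0 ≡ i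
  ⊕-identityʳ i = toℕ-injective (begin
    toℕ (i ⊕ 0)          ≡⟨ toℕ-⊕ i 0 ⟩
    (toℕ i + 0) % suc n  ≡⟨ cong (_% suc n) (ℕₚ.+-identityʳ (toℕ i)) ⟩
    toℕ i % suc n        ≡⟨ m<n⇒m%n≡m (toℕ<n i) ⟩
    toℕ i                ∎)
    where open ≡-Reasoning

  ⊕-period : (i : Fin (suc n)) → i ⊕ suc n ≡ i
  ⊕-period i = toℕ-injective (begin
    toℕ (i ⊕ suc n)          ≡⟨ toℕ-⊕ i (suc n) ⟩
    (toℕ i + suc n) % suc n  ≡⟨ [m+n]%n≡m%n (toℕ i) (suc n) ⟩
    toℕ i % suc n            ≡⟨ m<n⇒m%n≡m (toℕ<n i) ⟩
    toℕ i                    ∎)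
    where open ≡-Reasoning

  pred-mod-⊕1 : (i : Fin (suc n)) → pred-mod (i ⊕ 1) ≡ i
  pred-mod-⊕1 i = trans (⊕-+ i 1 n) (⊕-period i)

  ⊕1-pred-mod : (i : Fin (suc n)) → pred-mod i ⊕ 1 ≡ i
  ⊕1-pred-mod i = trans (⊕-+ i n 1) (trans (cong (i ⊕_) (ℕₚ.+-comm n 1)) (⊕-period i))

  ⊕1-↔ : Fin (suc n) ↔ Fin (suc n)
  ⊕1-↔ = mk↔ₛ′ (_⊕ 1) pred-mod ⊕1-pred-mod pred-mod-⊕1

Bool→ℕ : Bool → ℕ
Bool→ℕ b = if b then 1 else 0

count-suc : ∀ {k} (f : Fin (suc k) → Bool) → count f ≡ Bool→ℕ (f Fin.zero) + count (f ∘ Fin.suc)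
count-suc f with f Fin.zero
... | true  = refl
... | false = refl

count≡sum : ∀ {k} (f : Fin k → Bool) → count f ≡ ℕΣ.sum (Bool→ℕ ∘ f)
count≡sum {zero}  f = refl
count≡sum {suc k} f = trans (count-suc f) (cong (Bool→ℕ (f Fin.zero) +_) (count≡sum (f ∘ Fin.suc)))

count-permute : ∀ {k} (f : Fin k → Bool) (π : Fin k ↔ Fin k) → count (f ∘ Inverse.to π) ≡ count f
count-permute f π = begin
  count (f ∘ Inverse.to π)            ≡⟨ count≡sum (f ∘ Inverse.to π) ⟩
  ℕΣ.sum (Bool→ℕ ∘ f ∘ Inverse.to π)  ≡⟨ ℕΣ.sum-permute (Bool→ℕ ∘ f) π ⟨
  ℕΣ.sum (Bool→ℕ ∘ f)                 ≡⟨ count≡sum f ⟨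
  count f                             ∎
  where open ≡-Reasoning

0<count⇒∃ : ∀ {k} (f : Fin k → Bool) → 0 ℕ.< count f → ∃ λ v → f v ≡ true
0<count⇒∃ {suc k} f p rewrite count-suc f with f Fin.zero in f₀
... | true  = Fin.zero , f₀
... | false = Product.map Fin.suc id (0<count⇒∃ (f ∘ Fin.suc) p)

count-pigeonhole : ∀ {k} (f g : Fin k → Bool) → k ℕ.< count f + count g →
                   ∃ λ v → f v ≡ true × g v ≡ true
count-pigeonhole {suc k} f g p rewrite count-suc f | count-suc g
  with f Fin.zero in f₀ | g Fin.zero in g₀
... | true  | true  = Fin.zero , f₀ , g₀
... | true  | false = Product.map Fin.suc id (count-pigeonhole _ _ (ℕₚ.≤-pred p))
... | false | true  = Product.map Fin.suc id
                        (count-pigeonhole _ _ (ℕₚ.≤-pred (subst (suc k ℕ.<_) (ℕₚ.+-suc _ _) p)))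
... | false | false = Product.map Fin.suc id (count-pigeonhole _ _ (ℕₚ.<-trans (ℕₚ.n<1+n k) p))

∈-tabulate⁻ : ∀ {k} {f : Fin k → Bool} {v} → v ∈ tabulate f → f v ≡ true
∈-tabulate⁻ {f = f} {v} v∈ = trans (sym (lookup∘tabulate f v)) ([]=⇒lookup v∈)

∈-tabulate⁺ : ∀ {k} {f : Fin k → Bool} {v} → f v ≡ true → v ∈ tabulate f
∈-tabulate⁺ {f = f} {v} fv = lookup⇒[]= v (tabulate f) (trans (lookup∘tabulate f v) fv)

Linked-applyUpTo-++ : ∀ {a ℓ} {A : Set a} {_~_ : A → A → Set ℓ} (h : ℕ → A) (l : ℕ) (rest : List A) →
                      (∀ m → h m ~ h (suc m)) → Linked _~_ (h l ∷ rest) →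
                      Linked _~_ (applyUpTo h (suc l) ++ rest)
Linked-applyUpTo-++ h zero    rest h~ hl∷rest = hl∷rest
Linked-applyUpTo-++ h (suc l) rest h~ hl∷rest =
  h~ 0 ∷ Linked-applyUpTo-++ (h ∘ suc) l rest (h~ ∘ suc) hl∷rest

module _ {n : ℕ} {R : Digraph (suc n)} (F : HamiltonCycle R) where

  edge-alongF : ∀ i m → Edge R (vtx F (i ⊕ m)) (vtx F (i ⊕ suc m))
  edge-alongF i m = subst (Edge R (vtx F (i ⊕ m)) ∘ vtx F)
                          (trans (⊕-+ i m 1) (cong (i ⊕_) (ℕₚ.+-comm m 1)))
                          (cycleE F (i ⊕ m))

  skewed⇒shifted : ∀ A is B → SkewedTraverseFrom F A is B → IsWalk R (shiftedSeq F A is B)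
  skewed⇒shifted A []       B A→B           = A→B ∷ [-]
  skewed⇒shifted A (i ∷ is) B (A→Vᵢ , rest) =
    subst (Linked (Edge R) ∘ (A ∷_)) (sym (++-assoc (alongF F i) (concat (map (alongF F) is)) (B ∷ [])))
      (subst (λ xs → Linked (Edge R) (A ∷ xs ++ tail)) (sym (map-upTo (vtx F ∘ (i ⊕_)) (suc n)))
        (subst (Edge R A ∘ vtx F) (sym (⊕-identityʳ i)) A→Vᵢ
          ∷ Linked-applyUpTo-++ (vtx F ∘ (i ⊕_)) n tail (edge-alongF i)
              (skewed⇒shifted (vtx F (pred-mod i)) is B rest)))
    where tail = concat (map (alongF F) is) ++ B ∷ []

  skewed-snoc : ∀ A is j B → SkewedTraverseFrom F A is (vtx F j) → Edge R (vtx F (pred-mod j)) B →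
                SkewedTraverseFrom F A (is ++ j ∷ []) B
  skewed-snoc A []       j B A→Vⱼ          e = A→Vⱼ , e
  skewed-snoc A (i ∷ is) j B (A→Vᵢ , rest) e = A→Vᵢ , skewed-snoc _ is j B rest e

ℕ→ℚ≡mkℚ : ∀ n → ℕ→ℚ n ≡ mkℚ (ℤ.+ n) 0 (Coprime.sym (Coprime.1-coprimeTo n))
ℕ→ℚ≡mkℚ n = ℚₚ.normalize-coprime (Coprime.sym (Coprime.1-coprimeTo n))

ℕ→ℚ-+ : ∀ m n → ℕ→ℚ (m + n) ≡ ℕ→ℚ m ℚ.+ ℕ→ℚ n
ℕ→ℚ-+ m n = trans (cong₂ (λ a b → (a ℤ.+ b) ℚ./ 1) (sym (ℤₚ.*-identityʳ (ℤ.+ m)))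
                                                      (sym (ℤₚ.*-identityʳ (ℤ.+ n))))
                   (sym (cong₂ ℚ._+_ (ℕ→ℚ≡mkℚ m) (ℕ→ℚ≡mkℚ n)))

ℕ→ℚ-mono-≤ : ∀ {m n} → m ℕ.≤ n → ℕ→ℚ m ℚ.≤ ℕ→ℚ n
ℕ→ℚ-mono-≤ {m} {n} m≤n rewrite ℕ→ℚ≡mkℚ m | ℕ→ℚ≡mkℚ n =
  *≤* (ℤₚ.*-monoʳ-≤-nonNeg (ℤ.+ 1) (ℤ.+≤+ m≤n))

ℕ→ℚ-mono-< : ∀ {m n} → m ℕ.< n → ℕ→ℚ m ℚ.< ℕ→ℚ n
ℕ→ℚ-mono-< {m} {n} m<n rewrite ℕ→ℚ≡mkℚ m | ℕ→ℚ≡mkℚ n =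
  *<* (subst₂ ℤ._<_ (sym (ℤₚ.*-identityʳ (ℤ.+ m))) (sym (ℤₚ.*-identityʳ (ℤ.+ n))) (ℤ.+<+ m<n))

ℕ→ℚ-cancel-< : ∀ {m n} → ℕ→ℚ m ℚ.< ℕ→ℚ n → m ℕ.< n
ℕ→ℚ-cancel-< {m} {n} p rewrite ℕ→ℚ≡mkℚ m | ℕ→ℚ≡mkℚ n with p
... | *<* q = ℤₚ.drop‿+<+ (subst₂ ℤ._<_ (ℤₚ.*-identityʳ (ℤ.+ m)) (ℤₚ.*-identityʳ (ℤ.+ n)) q)

ℕ→ℚ-nonNeg : ∀ n → 0ℚ ℚ.≤ ℕ→ℚ n
ℕ→ℚ-nonNeg n = ℕ→ℚ-mono-≤ {0} {n} z≤n

i≤+∣i∣ : ∀ i → i ℤ.≤ ℤ.+ ℤ.∣ i ∣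
i≤+∣i∣ (ℤ.+ _)    = ℤₚ.≤-refl
i≤+∣i∣ ℤ.-[1+ _ ] = ℤ.-≤+

floor*↧≤↥ : ∀ p → ℚ.floor p ℤ.* ℚ.↧ p ℤ.≤ ℚ.↥ p
floor*↧≤↥ p@(mkℚ _ _ _) = [n/d]*d≤n (ℚ.↥ p) (ℚ.↧ p)

≤-∣ceiling∣ : ∀ p → p ℚ.≤ ℕ→ℚ ℤ.∣ ℚ.ceiling p ∣
≤-∣ceiling∣ p@(mkℚ _ _ _) = subst (p ℚ.≤_) (sym (ℕ→ℚ≡mkℚ ℤ.∣ c ∣)) (*≤* (begin
  ℚ.↥ p ℤ.* ℤ.+ 1           ≡⟨ ℤₚ.*-identityʳ (ℚ.↥ p) ⟩
  ℚ.↥ p                     ≡⟨ ℤₚ.neg-involutive (ℚ.↥ p) ⟨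
  ℤ.- ℤ.- ℚ.↥ p             ≡⟨ cong ℤ.-_ (ℚₚ.↥-neg p) ⟨
  ℤ.- ℚ.↥ (ℚ.- p)           ≤⟨ ℤₚ.neg-mono-≤ f*↧p≤↥[-p] ⟩
  ℤ.- (f ℤ.* ℚ.↧ p)         ≡⟨ ℤₚ.neg-distribˡ-* f (ℚ.↧ p) ⟩
  c ℤ.* ℚ.↧ p               ≤⟨ ℤₚ.*-monoʳ-≤-nonNeg (ℚ.↧ p) (i≤+∣i∣ c) ⟩
  ℤ.+ ℤ.∣ c ∣ ℤ.* ℚ.↧ p     ∎))
  where
  f = ℚ.floor (ℚ.- p)
  c = ℚ.ceiling p
  f*↧p≤↥[-p] : f ℤ.* ℚ.↧ p ℤ.≤ ℚ.↥ (ℚ.- p)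
  f*↧p≤↥[-p] = subst (λ d → f ℤ.* d ℤ.≤ ℚ.↥ (ℚ.- p)) (ℚₚ.↧-neg p) (floor*↧≤↥ (ℚ.- p))
  open ℤₚ.≤-Reasoning

1≤ceilInv*ν : ∀ ν (ν>0 : 0ℚ ℚ.< ν) → 1ℚ ℚ.≤ ℕ→ℚ (ceilInv ν ν>0) ℚ.* ν
1≤ceilInv*ν ν ν>0 = subst (ℚ._≤ ℕ→ℚ (ceilInv ν ν>0) ℚ.* ν) (ℚₚ.*-inverseˡ ν)
                      (ℚₚ.*-monoʳ-≤-nonNeg ν (≤-∣ceiling∣ (ℚ.1/ ν)))
  where instance _ = ℚ.>-nonZero ν>0
                 _ = ℚ.nonNegative (ℚₚ.<⇒≤ ν>0)

open +-*-Solver using (solve; _:+_; _:*_; _:-_; _:=_; con)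

ℕ→ℚ-suc : ∀ n → ℕ→ℚ (suc n) ≡ 1ℚ ℚ.+ ℕ→ℚ n
ℕ→ℚ-suc = ℕ→ℚ-+ 1

reaches-within : ∀ {lo hi δ} (c : ℕ → ℚ) → 0ℚ ℚ.≤ δ →
                 (∀ m → lo ℚ.< c m → c m ℚ.< hi → c m ℚ.+ δ ℚ.≤ c (suc m)) →
                 lo ℚ.< c 0 → ∀ n → hi ℚ.≤ c 0 ℚ.+ ℕ→ℚ n ℚ.* δ → ∃ λ m → m ℕ.≤ n × hi ℚ.≤ c m
reaches-within {hi = hi} c δ≥0 grow lo<c₀ n hi≤ with hi ℚ.≤? c 0
... | yes hi≤c₀ = 0 , z≤n , hi≤c₀
reaches-within {hi = hi} {δ} c δ≥0 grow lo<c₀ zero hi≤ | no hi≰c₀ =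
  contradiction (subst (hi ℚ.≤_) (trans (cong (c 0 ℚ.+_) (ℚₚ.*-zeroˡ δ)) (ℚₚ.+-identityʳ (c 0))) hi≤) hi≰c₀
reaches-within {lo} {hi} {δ} c δ≥0 grow lo<c₀ (suc n) hi≤ | no hi≰c₀ =
  Product.map suc (Product.map₁ s≤s) (reaches-within (c ∘ suc) δ≥0 (grow ∘ suc) lo<c₁ n hi≤′)
  where
  open ℚₚ.≤-Reasoning
  c₀+δ≤c₁ : c 0 ℚ.+ δ ℚ.≤ c 1
  c₀+δ≤c₁ = grow 0 lo<c₀ (ℚₚ.≰⇒> hi≰c₀)
  lo<c₁ : lo ℚ.< c 1
  lo<c₁ = begin-strict
    lo          <⟨ lo<c₀ ⟩
    c 0         ≡⟨ ℚₚ.+-identityʳ (c 0) ⟨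
    c 0 ℚ.+ 0ℚ  ≤⟨ ℚₚ.+-monoʳ-≤ (c 0) δ≥0 ⟩
    c 0 ℚ.+ δ   ≤⟨ c₀+δ≤c₁ ⟩
    c 1         ∎
  hi≤′ : hi ℚ.≤ c 1 ℚ.+ ℕ→ℚ n ℚ.* δ
  hi≤′ = begin
    hi                                    ≤⟨ hi≤ ⟩
    c 0 ℚ.+ ℕ→ℚ (suc n) ℚ.* δ             ≡⟨ cong (λ x → c 0 ℚ.+ x ℚ.* δ) (ℕ→ℚ-suc n) ⟩
    c 0 ℚ.+ (1ℚ ℚ.+ ℕ→ℚ n) ℚ.* δ          ≡⟨ solve 3 (λ x m d → x :+ (con 1ℚ :+ m) :* d := (x :+ d) :+ m :* d)
                                                    refl (c 0) (ℕ→ℚ n) δ ⟩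
    (c 0 ℚ.+ δ) ℚ.+ ℕ→ℚ n ℚ.* δ           ≤⟨ ℚₚ.+-monoˡ-≤ (ℕ→ℚ n ℚ.* δ) c₀+δ≤c₁ ⟩
    c 1 ℚ.+ ℕ→ℚ n ℚ.* δ                   ∎

[1-τ]K≤c+m[νK] : ∀ {τ ν K c m} → 0ℚ ℚ.≤ K → 0ℚ ℚ.≤ c → ν ℚ.≤ τ → 1ℚ ℚ.≤ (1ℚ ℚ.+ m) ℚ.* ν →
                 (1ℚ ℚ.- τ) ℚ.* K ℚ.≤ c ℚ.+ m ℚ.* (ν ℚ.* K)
[1-τ]K≤c+m[νK] {τ} {ν} {K} {c} {m} K≥0 c≥0 ν≤τ 1≤[1+m]ν = begin
  (1ℚ ℚ.- τ) ℚ.* K       ≤⟨ ℚₚ.*-monoʳ-≤-nonNeg K (ℚₚ.+-monoʳ-≤ 1ℚ (ℚₚ.neg-antimono-≤ ν≤τ)) ⟩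
  (1ℚ ℚ.- ν) ℚ.* K       ≤⟨ ℚₚ.*-monoʳ-≤-nonNeg K 1-ν≤mν ⟩
  (m ℚ.* ν) ℚ.* K        ≡⟨ ℚₚ.*-assoc m ν K ⟩
  m ℚ.* (ν ℚ.* K)        ≡⟨ ℚₚ.+-identityˡ _ ⟨
  0ℚ ℚ.+ m ℚ.* (ν ℚ.* K) ≤⟨ ℚₚ.+-monoˡ-≤ _ c≥0 ⟩
  c ℚ.+ m ℚ.* (ν ℚ.* K)  ∎
  where
  open ℚₚ.≤-Reasoning
  instance _ = ℚ.nonNegative K≥0
  1-ν≤mν : 1ℚ ℚ.- ν ℚ.≤ m ℚ.* ν
  1-ν≤mν = subst (1ℚ ℚ.- ν ℚ.≤_)
             (solve 2 (λ m v → (con 1ℚ :+ m) :* v :- v := m :* v) refl m ν)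
             (ℚₚ.+-monoˡ-≤ (ℚ.- ν) 1≤[1+m]ν)

K<x+y : ∀ {τ η K x y} → τ ℚ.< η → 0ℚ ℚ.< K → (1ℚ ℚ.- τ) ℚ.* K ℚ.≤ x → η ℚ.* K ℚ.≤ y → K ℚ.< x ℚ.+ y
K<x+y {τ} {η} {K} {x} {y} τ<η K>0 x≥ y≥ = begin-strict
  K                                ≡⟨ solve 2 (λ t k → k := (con 1ℚ :- t) :* k :+ t :* k) refl τ K ⟩
  (1ℚ ℚ.- τ) ℚ.* K ℚ.+ τ ℚ.* K     <⟨ ℚₚ.+-monoʳ-< ((1ℚ ℚ.- τ) ℚ.* K) (ℚₚ.*-monoˡ-<-pos K τ<η) ⟩
  (1ℚ ℚ.- τ) ℚ.* K ℚ.+ η ℚ.* K     ≤⟨ ℚₚ.+-mono-≤ x≥ y≥ ⟩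
  x ℚ.+ y                          ∎
  where
  open ℚₚ.≤-Reasoning
  instance _ = ℚ.positive K>0

module SkewedReach {n : ℕ} {R : Digraph (suc n)} (F : HamiltonCycle R) (A : Fin (suc n))
                   {ν : ℚ} (ν>0 : 0ℚ ℚ.< ν) where

  K : ℚ
  K = ℕ→ℚ (suc n)

  K>0 : 0ℚ ℚ.< K
  K>0 = ℕ→ℚ-mono-< {0} {suc n} (s≤s z≤n)

  νK>0 : 0ℚ ℚ.< ν ℚ.* K
  νK>0 = ℚₚ.positive⁻¹ _ {{ℚₚ.pos*pos⇒pos ν {{ℚ.positive ν>0}} K {{ℚ.positive K>0}}}}

  successor : Fin (suc n) ↔ Fin (suc n)
  successor = V F ↔-∘ (⊕1-↔ ↔-∘ ↔-sym (V F))

  σ : Fin (suc n) → Fin (suc n)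
  σ = Inverse.to successor

  index : Fin (suc n) → Fin (suc n)
  index = Inverse.from (V F)

  pred-σ : ∀ v → vtx F (pred-mod (index v ⊕ 1)) ≡ v
  pred-σ v = trans (cong (vtx F) (pred-mod-⊕1 (index v))) (Inverse.strictlyInverseˡ (V F) v)

  robustOutNbhd : (Fin (suc n) → Bool) → Fin (suc n) → Bool
  robustOutNbhd Y v = does (ν ℚ.* K ℚ.≤? ℕ→ℚ (inNbrsIn R (tabulate Y) v))

  ∈-robustOutNbhd : ∀ Y v → (v ∈ tabulate (robustOutNbhd Y) → InRobustOutNbhd R ν (tabulate Y) v) ×
                          (InRobustOutNbhd R ν (tabulate Y) v → v ∈ tabulate (robustOutNbhd Y))
  ∈-robustOutNbhd Y v =
      (λ v∈ → toWitness {a? = RN?}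
                (Equivalence.from T-≡ (trans (isYes≗does RN?) (∈-tabulate⁻ {f = robustOutNbhd Y} v∈))))
    , (λ v∈RN → ∈-tabulate⁺ {f = robustOutNbhd Y} (dec-true RN? v∈RN))
    where RN? = ν ℚ.* K ℚ.≤? ℕ→ℚ (inNbrsIn R (tabulate Y) v)

  robustOutNbhd⇒inNbr : ∀ Y w → robustOutNbhd Y w ≡ true → ∃ λ u → Y u ≡ true × Edge R u w
  robustOutNbhd⇒inNbr Y w h =
    Product.map₂ split (0<count⇒∃ _ (ℕ→ℚ-cancel-< (ℚₚ.<-≤-trans νK>0 νK≤)))
    where
    νK≤ : ν ℚ.* K ℚ.≤ ℕ→ℚ (inNbrsIn R (tabulate Y) w)
    νK≤ = proj₁ (∈-robustOutNbhd Y w) (∈-tabulate⁺ {f = robustOutNbhd Y} h)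
    split : ∀ {u} → lookup (tabulate Y) u ∧ E R u w ≡ true → Y u ≡ true × Edge R u w
    split {u} h = trans (sym (lookup∘tabulate Y u)) (∧-conicalˡ _ _ h) , ∧-conicalʳ _ _ h

  reach : ℕ → Fin (suc n) → Bool
  reach zero    = E R A ∘ σ
  reach (suc m) = robustOutNbhd (reach m) ∘ σ

  reach-sound : ∀ m u → reach m u ≡ true →
                ∃ λ is → length is ≡ suc m × (∀ {B} → Edge R u B → SkewedTraverseFrom F A is B)
  reach-sound zero u A→σu =
    (index u ⊕ 1) ∷ [] , refl , λ u→B → A→σu , subst (λ w → Edge R w _) (sym (pred-σ u)) u→B
  reach-sound (suc m) u σu∈RN =
    let (w , w∈ , w→σu) = robustOutNbhd⇒inNbr (reach m) (σ u) σu∈RN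
        (is , len , close) = reach-sound m w w∈
    in is ++ (index u ⊕ 1) ∷ []
     , trans (length-++ is) (trans (cong (_+ 1) len) (ℕₚ.+-comm (suc m) 1))
     , λ u→B → skewed-snoc F A is (index u ⊕ 1) _ (close w→σu)
                 (subst (λ w → Edge R w _) (sym (pred-σ u)) u→B)

  count-reach-zero : count (reach 0) ≡ outdeg R A
  count-reach-zero = count-permute (E R A) successor

  reach-grows : ∀ {τ} → RobustOutexpander R ν τ → ∀ m →
                τ ℚ.* K ℚ.< ℕ→ℚ (count (reach m)) → ℕ→ℚ (count (reach m)) ℚ.< (1ℚ ℚ.- τ) ℚ.* K →
                ℕ→ℚ (count (reach m)) ℚ.+ ν ℚ.* K ℚ.≤ ℕ→ℚ (count (reach (suc m)))
  reach-grows expander m lo hi =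
    subst (λ x → ℕ→ℚ (count (reach m)) ℚ.+ ν ℚ.* K ℚ.≤ ℕ→ℚ x)
          (sym (count-permute (robustOutNbhd (reach m)) successor))
          (expander (tabulate (reach m)) (tabulate (robustOutNbhd (reach m)))
                    (∈-robustOutNbhd (reach m)) lo hi)

short-skewedTraverse : ∀ {n} {R : Digraph (suc n)} (F : HamiltonCycle R) {η τ ν : ℚ} →
  0ℚ ℚ.< ν → ν ℚ.≤ τ → τ ℚ.< η →
  MinSemiDegreeAtLeast R (η ℚ.* ℕ→ℚ (suc n)) → RobustOutexpander R ν τ →
  ∀ r → 1ℚ ℚ.≤ ℕ→ℚ r ℚ.* ν → ∀ A B → ∃ λ t → 1 ℕ.≤ t × t ℕ.≤ r × SkewedTraverse F A B t
short-skewedTraverse F {ν = ν} ν>0 ν≤τ τ<η deg expander zero 1≤0ν A B =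
  contradiction (subst (1ℚ ℚ.≤_) (ℚₚ.*-zeroˡ ν) 1≤0ν) λ { (*≤* (ℤ.+≤+ ())) }
short-skewedTraverse {n} {R} F {η} {τ} {ν} ν>0 ν≤τ τ<η deg expander (suc r) 1≤[1+r]ν A B =
  let (m , m≤r , hi≤cₘ) = reaches-within {τ ℚ.* K} {(1ℚ ℚ.- τ) ℚ.* K} c (ℚₚ.<⇒≤ νK>0)
                            (reach-grows {τ} expander) lo<c₀ r hi≤c₀+rνK
      (u , u∈ , u→B) = count-pigeonhole (reach m) (λ w → E R w B)
                         (ℕ→ℚ-cancel-< (subst (K ℚ.<_) (sym (ℕ→ℚ-+ (count (reach m)) (indeg R B)))
                                          (K<x+y τ<η K>0 hi≤cₘ (proj₂ (deg B)))))
      (is , len , close) = reach-sound m u u∈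
  in suc m , s≤s z≤n , s≤s m≤r , is , len , close u→B
  where
  open SkewedReach F A ν>0
  c : ℕ → ℚ
  c m = ℕ→ℚ (count (reach m))
  lo<c₀ : τ ℚ.* K ℚ.< c 0
  lo<c₀ = ℚₚ.<-≤-trans (ℚₚ.*-monoˡ-<-pos K {{ℚ.positive K>0}} τ<η)
                       (subst (λ d → η ℚ.* K ℚ.≤ ℕ→ℚ d) (sym count-reach-zero) (proj₁ (deg A)))
  hi≤c₀+rνK : (1ℚ ℚ.- τ) ℚ.* K ℚ.≤ c 0 ℚ.+ ℕ→ℚ r ℚ.* (ν ℚ.* K)
  hi≤c₀+rνK = [1-τ]K≤c+m[νK] {τ} {ν} {K} {c 0} {ℕ→ℚ r}
                (ℕ→ℚ-nonNeg (suc n)) (ℕ→ℚ-nonNeg (count (reach 0))) ν≤τ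
                (subst (λ x → 1ℚ ℚ.≤ x ℚ.* ν) (ℕ→ℚ-suc r) 1≤[1+r]ν)

skewed⇒shiftedWalk : ∀ {n} {R : Digraph (suc n)} (F : HamiltonCycle R) {A B t} →
                     SkewedTraverse F A B t → ShiftedWalk F A B t
skewed⇒shiftedWalk F {A} {B} (is , len , traverse) = is , len , skewed⇒shifted F A is B traverse

mainTheorem13 : ∀ (η : ℚ) → 0ℚ ℚ.< η → η ℚ.< 1ℚ →
  Σ ℚ λ τ₀ → (0ℚ ℚ.< τ₀) ×
    (∀ (τ ν : ℚ) (ν>0 : 0ℚ ℚ.< ν) → ν ℚ.≤ τ → τ ℚ.≤ τ₀ →
     ∀ (k : ℕ) (R : Digraph k) →
     MinSemiDegreeAtLeast R (η ℚ.* ℕ→ℚ k) →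
     RobustOutexpander R ν τ →
     (F : HamiltonCycle R) →
     ∀ (A B : Fin k) → A ≢ B →
       (∃ λ t → (1 ℕ.≤ t) × (t ℕ.≤ ceilInv ν ν>0) × SkewedTraverse F A B t) ×
       (∃ λ t → (1 ℕ.≤ t) × (t ℕ.≤ ceilInv ν ν>0) × ShiftedWalk F A B t))
mainTheorem13 η η>0 _ = ½ ℚ.* η , ½η>0 , λ
  { τ ν ν>0 ν≤τ τ≤½η zero R _ _ _ () _ _
  ; τ ν ν>0 ν≤τ τ≤½η (suc n) R deg expander F A B _ →
      let traverse = short-skewedTraverse F ν>0 ν≤τ (ℚₚ.≤-<-trans τ≤½η ½η<η) deg expander
                       (ceilInv ν ν>0) (1≤ceilInv*ν ν ν>0) A B
      in traverse , Product.map₂ (Product.map₂ (Product.map₂ (skewed⇒shiftedWalk F))) traverse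
  }
  where
  instance _ = ℚ.positive η>0
  ½η>0 : 0ℚ ℚ.< ½ ℚ.* η
  ½η>0 = ℚₚ.positive⁻¹ _ {{ℚₚ.pos*pos⇒pos ½ η}}
  ½<1 : ½ ℚ.< 1ℚ
  ½<1 = *<* (ℤ.+<+ (s≤s (s≤s z≤n)))
  ½η<η : ½ ℚ.* η ℚ.< η
  ½η<η = subst (½ ℚ.* η ℚ.<_) (ℚₚ.*-identityˡ η) (ℚₚ.*-monoˡ-<-pos η ½<1)
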